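{- Let $F$ be a graph, let $1\le s\le r$ be integers, and let $F'$ be an induced subgraph of $F$ such that the graph obtained from $F$ by deleting the vertices of $F'$ is $s$-colorable. For every $c>0$ there exist $\delta>0$ and $n_0$ such that the following holds for $n\ge n_0$. Let $G$ be an $n$-vertex graph with a partition $V(G)=A_1\cup\dots\cup A_r$ such that $|A_i|\ge cn$ for each $i$ and each vertex of $A_i$ is adjacent to all but at most $\delta n$ vertices outside $A_i$. If a copy of $F'$ is embedded into $G$ avoiding $A_1,\dots,A_s$, then this copy of $F'$ can be extended to a copy of $F$ in $G$.
   Context: All graphs are finite and simple; "copy" means a (not necessarily induced) subgraph isomorphic to the given graph, and extending means the copy of $F$ contains the given copy of $F'$ in the position of $F'$. The paper phrases the hypotheses as $|A_i|=\Theta(n)$ and "all but $o(n)$ vertices outside $A_i$"; the quantified form above is the precise meaning. -}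

module Defs where

open import Data.Nat using (ℕ; zero; suc; _+_)
open import Data.Fin using (Fin; zero; suc)
open import Data.Bool using (Bool; true; false)
open import Relation.Binary.PropositionalEquality using (_≡_; _≢_)
open import Data.Product using (Σ; _×_)

record Graph (n : ℕ) : Set where
  field
    adj    : Fin n → Fin n → Bool
    sym    : ∀ u v → adj u v ≡ adj v u
    irrefl : ∀ u → adj u u ≡ false
open Graph public

count : ∀ {n} → (Fin n → Bool) → ℕ
count {zero}  P = 0
count {suc n} P with P zero
... | true  = suc (count (λ i → P (suc i)))
... | false = count (λ i → P (suc i))

Injective : ∀ {a b} → (Fin a → Fin b) → Set
Injective f = ∀ u v → f u ≡ f v → u ≡ v

IsCopy : ∀ {a b} → Graph a → Graph b → (Fin a → Fin b) → Set
IsCopy H G f = Injective f × (∀ u v → adj H u v ≡ true → adj G (f u) (f v) ≡ true)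

IsInducedSub : ∀ {a b} → Graph a → Graph b → (Fin a → Fin b) → Set
IsInducedSub H' H ι = Injective ι × (∀ u v → adj H' u v ≡ adj H (ι u) (ι v))

RestColourable : ∀ {a b} → Graph b → (Fin a → Fin b) → ℕ → Set
RestColourable {a} H ι s =
  Σ (Fin _ → Fin s) λ col →
    ∀ u v → (∀ i → ι i ≢ u) → (∀ i → ι i ≢ v) →
      adj H u v ≡ true → col u ≢ col v

{-# OPTIONS --safe #-}
-- Colour F − F' with s colours and send a new vertex of colour j into the class A_j.
-- As the copy of F' avoids A_1, …, A_s, every edge of F that is not inside F' then joins
-- two vertices whose targets lie in different classes, and the new vertices can be
-- embedded greedily: for k = |V(F)|, c = p / q and δ = 1 / b with b = 2q(k + 1), A_j contains
-- fewer than k(1 + δn) ≤ cn vertices that are already used or are non-adjacent to a used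
-- vertex of another class, so a suitable vertex of A_j is always available.
module Submission where

open import Defs hiding (sym)
open import Data.Nat using (ℕ; zero; suc; _+_; _*_; _≤_; _<_; _≥_; z≤n; s≤s)
open import Data.Nat.Properties
  using (≤-trans; ≤-reflexive; ≤-<-trans; <-irrefl; <⇒≱; n≤1+n; n<1+n; m≤m+n;
         +-suc; +-comm; +-monoʳ-≤; +-monoˡ-≤; +-cancelˡ-<;
         *-suc; *-zeroʳ; *-assoc; *-distribˡ-+; *-monoʳ-≤; *-monoˡ-<; module ≤-Reasoning)
open import Data.Fin using (Fin; zero; suc; toℕ; inject≤)
open import Data.Fin.Properties using (_≟_; any?; toℕ<n; toℕ-inject≤; inject≤-injective)
open import Data.Bool using (Bool; true; false; not; _∧_; _∨_)
open import Data.Bool.Properties using (∨-conicalˡ; ∨-conicalʳ; ∧-conicalˡ; ∧-conicalʳ; not-injective)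
open import Data.List using (List; []; _∷_; allFin)
open import Data.List.Membership.Propositional using (_∈_)
open import Data.List.Membership.Propositional.Properties using (∈-allFin)
open import Data.List.Relation.Unary.Any as Any using (here; there)
open import Data.Vec.Functional using (updateAt)
open import Data.Vec.Functional.Properties using (updateAt-updates; updateAt-minimal)
open import Data.Product using (Σ; _×_; _,_; ∃)
open import Data.Sum using (_⊎_; inj₁; inj₂)
open import Data.Empty using (⊥; ⊥-elim)
open import Function using (_∘_; const)
open import Relation.Nullary using (¬_; Dec; yes; no)
open import Relation.Nullary.Decidable using (⌊_⌋; _⊎-dec_; ⌊⌋-map′)
open import Relation.Unary using (Decidable; _⊆_)
open import Relation.Binary.PropositionalEquality
  using (_≡_; _≢_; refl; sym; trans; cong; subst; subst₂)

count-false : ∀ n → count {n} (λ _ → false) ≡ 0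
count-false zero    = refl
count-false (suc n) = count-false n

count-cong : ∀ {n} {P Q : Fin n → Bool} → (∀ i → P i ≡ Q i) → count P ≡ count Q
count-cong {zero}          _  = refl
count-cong {suc n} {P} {Q} eq with P zero | Q zero | eq zero
... | true  | true  | refl = cong suc (count-cong (eq ∘ suc))
... | false | false | refl = count-cong (eq ∘ suc)

count-≟ : ∀ {n} (v : Fin n) → count (λ w → ⌊ w ≟ v ⌋) ≡ 1
count-≟ {suc n} zero = cong suc (count-false n)
count-≟ (suc v)      = trans (count-cong (λ w → ⌊⌋-map′ _ _ (w ≟ v))) (count-≟ v)

count-∨ : ∀ {n} (P Q : Fin n → Bool) → count (λ w → P w ∨ Q w) ≤ count P + count Q
count-∨ {zero}  P Q = z≤n
count-∨ {suc n} P Q with P zero | Q zero | count-∨ (P ∘ suc) (Q ∘ suc)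
... | true  | true  | ih = s≤s (≤-trans ih (+-monoʳ-≤ _ (n≤1+n _)))
... | true  | false | ih = s≤s ih
... | false | true  | ih = ≤-trans (s≤s ih) (≤-reflexive (sym (+-suc (count (P ∘ suc)) _)))
... | false | false | ih = ih

count-split : ∀ {n} (P Q : Fin n → Bool) →
  count P ≤ count (λ w → P w ∧ not (Q w)) + count Q
count-split {zero}  P Q = z≤n
count-split {suc n} P Q with P zero | Q zero | count-split (P ∘ suc) (Q ∘ suc)
... | true  | true  | ih =
  ≤-trans (s≤s ih) (≤-reflexive (sym (+-suc (count (λ w → P (suc w) ∧ not (Q (suc w)))) _)))
... | true  | false | ih = s≤s ih
... | false | true  | ih = ≤-trans ih (+-monoʳ-≤ _ (n≤1+n _))
... | false | false | ih = ih

count-witness : ∀ {n} (P : Fin n → Bool) → 0 < count P → ∃ λ w → P w ≡ true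
count-witness {suc n} P pos with P zero in eq
... | true  = zero , eq
... | false = let w , Pw = count-witness (P ∘ suc) pos in suc w , Pw

count-avoid : ∀ {k n} (m N : ℕ) (P : Fin n → Bool) (B : Fin k → Fin n → Bool) →
  (∀ x → m * count (B x) ≤ N) → k * N < m * count P →
  ∃ λ w → P w ≡ true × (∀ x → B x w ≡ false)
count-avoid {zero} m N P B _ 0<mP with count P in eq
... | zero  = ⊥-elim (<-irrefl (sym (*-zeroʳ m)) 0<mP)
... | suc _ = let w , Pw = count-witness P (subst (0 <_) (sym eq) (s≤s z≤n)) in w , Pw , λ ()
count-avoid {suc k} m N P B bound N+kN<mP =
  let w , P′w , avoids = count-avoid m N P′ (B ∘ suc) (bound ∘ suc) kN<mP′
  in w , ∧-conicalˡ _ _ P′w , λ { zero → not-injective (∧-conicalʳ _ _ P′w) ; (suc x) → avoids x }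
  where
  open ≤-Reasoning
  P′ : Fin _ → Bool
  P′ w = P w ∧ not (B zero w)
  kN<mP′ : k * N < m * count P′
  kN<mP′ = +-cancelˡ-< N _ _ (begin-strict
    N + k * N                         <⟨ N+kN<mP ⟩
    m * count P                       ≤⟨ *-monoʳ-≤ m (count-split P (B zero)) ⟩
    m * (count P′ + count (B zero))   ≡⟨ *-distribˡ-+ m _ _ ⟩
    m * count P′ + m * count (B zero) ≤⟨ +-monoʳ-≤ _ (bound zero) ⟩
    m * count P′ + N                  ≡⟨ +-comm _ N ⟩
    N + m * count P′                  ∎)

classSize : ∀ {n r} → (Fin n → Fin r) → Fin r → ℕ
classSize part c = count (λ v → ⌊ part v ≟ c ⌋)

crossNonDegree : ∀ {n r} → Graph n → (Fin n → Fin r) → Fin n → ℕ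
crossNonDegree G part v = count (λ w → not ⌊ part w ≟ part v ⌋ ∧ not (adj G v w))

record FreshNeighbour {k n r} (G : Graph n) (part : Fin n → Fin r)
                      (f : Fin k → Fin n) (c : Fin r) : Set where
  field
    vertex   : Fin n
    in-class : part vertex ≡ c
    fresh    : ∀ x → vertex ≢ f x
    joined   : ∀ x → part (f x) ≢ c → adj G (f x) vertex ≡ true

fresh-neighbour : ∀ {k n r} (G : Graph n) (part : Fin n → Fin r)
  (f : Fin k → Fin n) (c : Fin r) (m N : ℕ) →
  (∀ x → m * crossNonDegree G part (f x) ≤ N) → k * (m + N) < m * classSize part c →
  FreshNeighbour G part f c
fresh-neighbour G part f c m N sparse budget =
  let w , w∈c , avoids = count-avoid m (m + N) (λ v → ⌊ part v ≟ c ⌋) bad bad-bound budget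
  in record
    { vertex   = w
    ; in-class = isYes-true (part w ≟ c) w∈c
    ; fresh    = λ x → isYes-false (w ≟ f x) (∨-conicalˡ _ _ (avoids x))
    ; joined   = λ x fx∉c → adjacent-of (part w ≟ part (f x))
        (λ e → fx∉c (trans (sym e) (isYes-true (part w ≟ c) w∈c))) (∨-conicalʳ _ _ (avoids x))
    }
  where
  open ≤-Reasoning
  bad : Fin _ → Fin _ → Bool
  bad x w = ⌊ w ≟ f x ⌋ ∨ (not ⌊ part w ≟ part (f x) ⌋ ∧ not (adj G (f x) w))
  bad-bound : ∀ x → m * count (bad x) ≤ m + N
  bad-bound x = begin
    m * count (bad x)
      ≤⟨ *-monoʳ-≤ m (count-∨ (λ w → ⌊ w ≟ f x ⌋) _) ⟩
    m * (count (λ w → ⌊ w ≟ f x ⌋) + crossNonDegree G part (f x))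
      ≡⟨ cong (λ t → m * (t + crossNonDegree G part (f x))) (count-≟ (f x)) ⟩
    m * suc (crossNonDegree G part (f x))                   ≡⟨ *-suc m _ ⟩
    m + m * crossNonDegree G part (f x)                     ≤⟨ +-monoʳ-≤ m (sparse x) ⟩
    m + N                                                   ∎
  isYes-true : ∀ {A : Set} (a? : Dec A) → ⌊ a? ⌋ ≡ true → A
  isYes-true (yes a) _ = a
  isYes-false : ∀ {A : Set} (a? : Dec A) → ⌊ a? ⌋ ≡ false → ¬ A
  isYes-false (no ¬a) _ = ¬a
  adjacent-of : ∀ {A : Set} (a? : Dec A) {b} → ¬ A → (not ⌊ a? ⌋ ∧ not b) ≡ false → b ≡ true
  adjacent-of (yes a) ¬a _ = ⊥-elim (¬a a)
  adjacent-of (no _) {true} _ _ = refl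

module GreedyEmbedding {k n r} (F : Graph k) (G : Graph n)
                       (part : Fin n → Fin r) (cls : Fin k → Fin r) where

  record ClassedCopyOn (P : Fin k → Set) (f : Fin k → Fin n) : Set where
    field
      classed   : ∀ {u} → P u → part (f u) ≡ cls u
      injective : ∀ {u v} → P u → P v → f u ≡ f v → u ≡ v
      edges     : ∀ {u v} → P u → P v → adj F u v ≡ true → adj G (f u) (f v) ≡ true
  open ClassedCopyOn

  restrict : ∀ {P Q f} → Q ⊆ P → ClassedCopyOn P f → ClassedCopyOn Q f
  restrict Q⊆P φ = record
    { classed   = classed φ ∘ Q⊆P
    ; injective = λ p q → injective φ (Q⊆P p) (Q⊆P q)
    ; edges     = λ p q → edges φ (Q⊆P p) (Q⊆P q)
    }

  extend : ∀ {P f u} (w : FreshNeighbour G part f (cls u)) → ClassedCopyOn P f → ¬ P u →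
    (∀ {v} → P v → adj F u v ≡ true → cls u ≢ cls v) →
    ClassedCopyOn (λ v → P v ⊎ v ≡ u) (updateAt f u (const (FreshNeighbour.vertex w)))
  extend {P} {f} {u} w φ u∉P proper = record
    { classed   = λ { (inj₁ p) → trans (cong part (old p)) (classed φ p)
                    ; (inj₂ refl) → trans (cong part new) in-class }
    ; injective = λ
        { (inj₁ p) (inj₁ q) e → injective φ p q (trans (sym (old p)) (trans e (old q)))
        ; (inj₁ p) (inj₂ refl) e → ⊥-elim (fresh _ (trans (sym new) (trans (sym e) (old p))))
        ; (inj₂ refl) (inj₁ q) e → ⊥-elim (fresh _ (trans (sym new) (trans e (old q))))
        ; (inj₂ refl) (inj₂ refl) _ → refl }
    ; edges     = λ
        { (inj₁ p) (inj₁ q) a → adjacent (old p) (old q) (edges φ p q a)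
        ; (inj₁ p) (inj₂ refl) a →
            adjacent (old p) new (vertex-joined p (trans (Graph.sym F _ _) a))
        ; (inj₂ refl) (inj₁ q) a →
            adjacent new (old q) (trans (Graph.sym G _ _) (vertex-joined q a))
        ; (inj₂ refl) (inj₂ refl) a → loop-free a }
    }
    where
    open FreshNeighbour w
    f′ : Fin k → Fin n
    f′ = updateAt f u (const vertex)
    new : f′ u ≡ vertex
    new = updateAt-updates u f
    old : ∀ {v} → P v → f′ v ≡ f v
    old {v} p = updateAt-minimal v u f (λ { refl → u∉P p })
    vertex-joined : ∀ {v} → P v → adj F u v ≡ true → adj G (f v) vertex ≡ true
    vertex-joined p a = joined _ (λ e → proper p a (trans (sym e) (classed φ p)))
    adjacent : ∀ {x x′ y y′} → x′ ≡ x → y′ ≡ y → adj G x y ≡ true → adj G x′ y′ ≡ true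
    adjacent x′≡x y′≡y = subst₂ (λ x y → adj G x y ≡ true) (sym x′≡x) (sym y′≡y)
    loop-free : ∀ {v} → adj F v v ≡ true → adj G (f′ v) (f′ v) ≡ true
    loop-free {v} a with trans (sym a) (irrefl F v)
    ... | ()

  greedy-extension : (S : Fin k → Set) → Decidable S → (f₀ : Fin k → Fin n) →
    ClassedCopyOn S f₀ →
    (∀ {u v} → ¬ S u → adj F u v ≡ true → cls u ≢ cls v) →
    (∀ f u → FreshNeighbour G part f (cls u)) →
    Σ (Fin k → Fin n) λ φ → IsCopy F G φ × (∀ {u} → S u → φ u ≡ f₀ u)
  greedy-extension S S? f₀ seed proper supply =
    let φ , copy , agrees = place (allFin k)
    in φ , ((λ u v → injective copy (everywhere u) (everywhere v))
           , (λ u v → edges copy (everywhere u) (everywhere v))) , agrees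
    where
    Placed : List (Fin k) → Fin k → Set
    Placed xs u = S u ⊎ u ∈ xs

    everywhere : ∀ u → Placed (allFin k) u
    everywhere u = inj₂ (∈-allFin u)

    place : ∀ xs → Σ (Fin k → Fin n) λ f →
      ClassedCopyOn (Placed xs) f × (∀ {u} → S u → f u ≡ f₀ u)
    place [] = f₀ , restrict (λ { (inj₁ s) → s }) seed , λ _ → refl
    place (x ∷ xs) with place xs | S? x ⊎-dec Any.any? (x ≟_) xs
    ... | f , copy , agrees | yes placed =
      f , restrict (λ { (inj₁ s) → inj₁ s ; (inj₂ (here refl)) → placed
                      ; (inj₂ (there m)) → inj₂ m }) copy , agrees
    ... | f , copy , agrees | no unplaced =
      updateAt f x (const (FreshNeighbour.vertex (supply f x))) ,
      restrict (λ { (inj₁ s) → inj₁ (inj₁ s) ; (inj₂ (here refl)) → inj₂ refl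
                  ; (inj₂ (there m)) → inj₁ (inj₂ m) })
               (extend (supply f x) copy unplaced (λ _ → proper (unplaced ∘ inj₁))) ,
      λ s → trans (updateAt-minimal _ x f (λ { refl → unplaced (inj₁ s) })) (agrees s)

module Seed {k k' n r s} (ι : Fin k' → Fin k) (ι-inj : Injective ι) (ψ : Fin k' → Fin n)
            (part : Fin n → Fin r) (col : Fin k → Fin s) (s≤r : s ≤ r) (default : Fin n) where

  InImage : Fin k → Set
  InImage u = ∃ λ i → ι i ≡ u

  inImage? : Decidable InImage
  inImage? u = any? (λ i → ι i ≟ u)

  seedMap : Fin k → Fin n
  seedMap u with inImage? u
  ... | yes (i , _) = ψ i
  ... | no _        = default

  seedClass : Fin k → Fin r
  seedClass u with inImage? u
  ... | yes (i , _) = part (ψ i)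
  ... | no _        = inject≤ (col u) s≤r

  seedMap-ι : ∀ i → seedMap (ι i) ≡ ψ i
  seedMap-ι i with inImage? (ι i)
  ... | yes (j , ιj≡ιi) = cong ψ (ι-inj j i ιj≡ιi)
  ... | no ∉image       = ⊥-elim (∉image (i , refl))

  seedClass-ι : ∀ i → seedClass (ι i) ≡ part (ψ i)
  seedClass-ι i with inImage? (ι i)
  ... | yes (j , ιj≡ιi) = cong (part ∘ ψ) (ι-inj j i ιj≡ιi)
  ... | no ∉image       = ⊥-elim (∉image (i , refl))

  seedClass-outside : ∀ {u} → ¬ InImage u → seedClass u ≡ inject≤ (col u) s≤r
  seedClass-outside {u} ∉image with inImage? u
  ... | yes image = ⊥-elim (∉image image)
  ... | no _      = refl

  open GreedyEmbedding using (ClassedCopyOn)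

  seed-copy : ∀ {F : Graph k} {F' : Graph k'} {G : Graph n} →
    (∀ i j → adj F' i j ≡ adj F (ι i) (ι j)) → IsCopy F' G ψ →
    ClassedCopyOn F G part seedClass InImage seedMap
  seed-copy {G = G} ι-induced (ψ-inj , ψ-edges) = record
    { classed   = λ { (i , refl) → trans (cong part (seedMap-ι i)) (sym (seedClass-ι i)) }
    ; injective = λ { (i , refl) (j , refl) e →
        cong ι (ψ-inj i j (trans (sym (seedMap-ι i)) (trans e (seedMap-ι j)))) }
    ; edges     = λ { (i , refl) (j , refl) a →
        subst₂ (λ x y → adj G x y ≡ true) (sym (seedMap-ι i)) (sym (seedMap-ι j))
               (ψ-edges i j (trans (ι-induced i j) a)) }
    }

  seed-proper : ∀ {F : Graph k} →
    (∀ u v → (∀ i → ι i ≢ u) → (∀ i → ι i ≢ v) → adj F u v ≡ true → col u ≢ col v) →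
    (∀ i → s ≤ toℕ (part (ψ i))) →
    ∀ {u v} → ¬ InImage u → adj F u v ≡ true → seedClass u ≢ seedClass v
  seed-proper col-proper avoids {u} {v} u∉image a e = distinct (inImage? v)
    where
    u-class : seedClass u ≡ inject≤ (col u) s≤r
    u-class = seedClass-outside u∉image
    distinct : Dec (InImage v) → ⊥
    distinct (yes (i , ιi≡v)) =
      <⇒≱ (≤-<-trans (≤-reflexive (toℕ-inject≤ (col u) s≤r)) (toℕ<n (col u)))
          (subst (λ c → s ≤ toℕ c) (sym (trans (sym u-class) u-class≡ψi)) (avoids i))
      where
      u-class≡ψi : seedClass u ≡ part (ψ i)
      u-class≡ψi = trans e (trans (cong seedClass (sym ιi≡v)) (seedClass-ι i))
    distinct (no v∉image) =
      col-proper u v (λ i → u∉image ∘ (i ,_)) (λ i → v∉image ∘ (i ,_)) a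
        (inject≤-injective s≤r s≤r _ _
          (trans (sym u-class) (trans e (seedClass-outside v∉image))))

greedy-budget : ∀ k q n A → suc k * (2 * q) ≤ n → 0 < n → n ≤ q * A →
  k * (suc k * (2 * q) + 1 * n) < suc k * (2 * q) * A
greedy-budget k q n@(suc _) A b≤n _ n≤qA = begin-strict
  k * (suc k * (2 * q) + 1 * n) ≤⟨ *-monoʳ-≤ k (+-monoˡ-≤ (1 * n) b≤n) ⟩
  k * (2 * n)                   <⟨ *-monoˡ-< (2 * n) (n<1+n k) ⟩
  suc k * (2 * n)               ≤⟨ *-monoʳ-≤ (suc k) (*-monoʳ-≤ 2 n≤qA) ⟩
  suc k * (2 * (q * A))         ≡⟨ cong (suc k *_) (sym (*-assoc 2 q A)) ⟩
  suc k * (2 * q * A)           ≡⟨ sym (*-assoc (suc k) (2 * q) A) ⟩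
  suc k * (2 * q) * A           ∎
  where open ≤-Reasoning

dense-fresh-neighbour : ∀ {k n r} (G : Graph n) (part : Fin n → Fin r) (q : ℕ) →
  suc k * (2 * q) ≤ n → 0 < n → (∀ c → n ≤ q * classSize part c) →
  (∀ v → suc k * (2 * q) * crossNonDegree G part v ≤ 1 * n) →
  (f : Fin k → Fin n) (c : Fin r) → FreshNeighbour G part f c
dense-fresh-neighbour {k} {n} G part q b≤n 0<n large sparse f c =
  fresh-neighbour G part f c (suc k * (2 * q)) (1 * n) (sparse ∘ f)
    (greedy-budget k q n (classSize part c) b≤n 0<n (large c))

lemma2p2 : ∀ {k k'} (F : Graph k) (F' : Graph k') (ι : Fin k' → Fin k) (s r : ℕ) →
    1 ≤ s → s ≤ r → IsInducedSub F' F ι → RestColourable F ι s →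
    -- c = p / q > 0
    (p q : ℕ) → 1 ≤ p → 1 ≤ q →
    -- δ = a / b > 0, and n₀
    Σ ℕ λ a → Σ ℕ λ b → Σ ℕ λ n₀ → 1 ≤ a × 1 ≤ b ×
    (∀ n → n ≥ n₀ → (G : Graph n) → (part : Fin n → Fin r) →
      (∀ i → p * n ≤ q * count (λ v → ⌊ part v ≟ i ⌋)) →
      (∀ v → b * count (λ w → not ⌊ part w ≟ part v ⌋ ∧ not (adj G v w)) ≤ a * n) →
      (ψ : Fin k' → Fin n) → IsCopy F' G ψ → (∀ i → s ≤ toℕ (part (ψ i))) →
      Σ (Fin k → Fin n) λ φ → IsCopy F G φ × (∀ i → φ (ι i) ≡ ψ i))
lemma2p2 {k} F F' ι s r _ s≤r (ι-inj , ι-induced) (col , col-proper) (suc p) q _ (s≤s z≤n) =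
  1 , suc k * (2 * q) , suc k * (2 * q) , s≤s z≤n , s≤s z≤n ,
  λ { zero ()
    ; n@(suc _) b≤n G part large sparse ψ ψ-copy avoids →
        let open Seed ι ι-inj ψ part col s≤r zero
            φ , φ-copy , φ-agrees = GreedyEmbedding.greedy-extension F G part seedClass
              InImage inImage? seedMap (seed-copy {F} {F'} ι-induced ψ-copy)
              (seed-proper {F} col-proper avoids)
              (λ f u → dense-fresh-neighbour G part q b≤n (s≤s z≤n)
                         (λ c → ≤-trans (m≤m+n n _) (large c)) sparse f (seedClass u))
        in φ , φ-copy , λ i → trans (φ-agrees (i , refl)) (seedMap-ι i) }
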